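{- Let $G$ be a graph on $n$ vertices and $k\ge 0$ an integer such that $G$ admits a $2$-valid edge coloring using at least $n-k$ colors. Then $\Delta(G)\le 3k+6$.
   Context: All graphs are finite, simple and undirected; $\Delta(G)$ is the maximum degree of $G$. An edge coloring of $G=(V,E)$ using $m$ colors is a surjective map $c:E\to[m]$; it is $2$-valid if for every vertex $v$ the edges incident to $v$ receive at most $2$ distinct colors. -}

module Defs where

open import Data.Nat using (ℕ; _≤_; _+_)
open import Data.Bool using (Bool; true; false; if_then_else_)
open import Data.Fin using (Fin)
open import Data.List using (map; allFin)
open import Data.Nat.ListAction using (sum)
open import Data.Product using (Σ; ∃; ∃-syntax; _×_)
open import Data.Sum using (_⊎_)
open import Relation.Binary.PropositionalEquality using (_≡_)
open import Relation.Nullary using (¬_)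

record Graph (n : ℕ) : Set where
  field
    adj   : Fin n → Fin n → Bool
    sym   : ∀ u v → adj u v ≡ adj v u
    irrefl : ∀ v → adj v v ≡ false

open Graph public

Adj : ∀ {n} → Graph n → Fin n → Fin n → Set
Adj G u v = adj G u v ≡ true

degree : ∀ {n} → Graph n → Fin n → ℕ
degree {n} G v = sum (map (λ u → if adj G v u then 1 else 0) (allFin n))

MaxDegreeAtMost : ∀ {n} → Graph n → ℕ → Set
MaxDegreeAtMost {n} G d = ∀ (v : Fin n) → degree G v ≤ d

-- An edge coloring with m colors: a colour for each edge {u,v}
-- (given on ordered adjacent pairs, independent of orientation),
-- surjective onto Fin m.
record EdgeColoring {n : ℕ} (G : Graph n) (m : ℕ) : Set where
  field
    col     : Fin n → Fin n → Fin m
    col-sym : ∀ u v → Adj G u v → col u v ≡ col v u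
    surj    : ∀ (x : Fin m) → ∃[ u ] ∃[ v ] (Adj G u v × col u v ≡ x)

open EdgeColoring public

-- 2-valid: the edges incident to any vertex v carry at most 2 distinct
-- colours, i.e. no three edges at v have pairwise distinct colours.
TwoValid : ∀ {n m} {G : Graph n} → EdgeColoring G m → Set
TwoValid {n} {m} {G} c =
  ∀ (v a b d : Fin n) → Adj G v a → Adj G v b → Adj G v d →
    ¬ (¬ col c v a ≡ col c v b × ¬ col c v a ≡ col c v d × ¬ col c v b ≡ col c v d)

-- The proof is a double count of the pairs (u, x) such that colour x is
-- seen at vertex u (lies on an edge at u).  Write load u for the number of
-- colours seen at u and spread x for the number of vertices seeing x.
--   * 2-validity gives load u ≤ 2, so Σₓ spread x = Σᵤ load u ≤ 2n;
--   * surjectivity gives spread x ≥ 2 (the two ends of an edge of colour x);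
--   * every neighbour of v sees a colour also seen at v, and v sees its own
--     colours, so deg v + load v ≤ Σₓ [x seen at v]·spread x.
-- Combining, deg v + load v + 2m ≤ Σₓ spread x + 2·load v ≤ 2n + 2·load v,
-- hence deg v + 2m ≤ 2n + 2 and deg v ≤ 2k + 2 ≤ 3k + 6.
module Submission where

open import Defs
open import Data.Nat using (ℕ; zero; suc; _≤_; _∸_; _+_; _*_; z≤n; s≤s)
open import Data.Nat.Properties hiding (_≟_)
open import Data.Nat.Tactic.RingSolver using (solve-∀)
import Data.Nat.ListAction as List
open import Data.Bool using (true; false; if_then_else_)
open import Data.Bool.Properties using () renaming (_≟_ to _≟ᵇ_)
open import Data.Fin using (Fin; zero; suc; punchOut)
open import Data.Fin.Properties using (any?; _≟_; punchIn-punchOut)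
open import Data.List using (tabulate)
open import Data.List.Properties using (map-tabulate)
open import Data.Vec.Functional using (removeAt)
open import Algebra.Properties.Semiring.Sum +-*-semiring
  using (sum; sum-remove; sum-replicate-zero; sum-cong-≗; ∑-distrib-+; ∑-comm; *-distribˡ-sum)
open import Data.Product using (Σ; ∃-syntax; _×_; _,_)
open import Data.Sum using (_⊎_; inj₁; inj₂)
open import Data.Empty using (⊥-elim)
open import Function using (id; _∘_)
open import Relation.Binary.PropositionalEquality renaming (sym to ≡-sym)
open import Relation.Nullary using (¬_; Dec; does; yes; no)
open import Relation.Nullary.Decidable using (_×-dec_; ¬?; decidable-stable)

sum-mono-≤ : ∀ {n} (f g : Fin n → ℕ) → (∀ i → f i ≤ g i) → sum f ≤ sum g
sum-mono-≤ {zero}  f g f≤g = z≤n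
sum-mono-≤ {suc n} f g f≤g =
  +-mono-≤ (f≤g zero) (sum-mono-≤ (λ i → f (suc i)) (λ i → g (suc i)) (λ i → f≤g (suc i)))

≤-sum : ∀ {n} (f : Fin n → ℕ) (a : Fin n) → f a ≤ sum f
≤-sum {suc n} f a = ≤-trans (m≤m+n (f a) _) (≤-reflexive (≡-sym (sum-remove f)))

≤-sum₂ : ∀ {n} (f : Fin n → ℕ) {a b : Fin n} → ¬ a ≡ b → f a + f b ≤ sum f
≤-sum₂ {suc n} f {a} {b} a≢b = begin
  f a + f b                                   ≡⟨ cong (λ j → f a + f j) (≡-sym (punchIn-punchOut a≢b)) ⟩
  f a + removeAt f a (punchOut a≢b)           ≤⟨ +-monoʳ-≤ (f a) (≤-sum (removeAt f a) (punchOut a≢b)) ⟩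
  f a + sum (removeAt f a)                    ≡⟨ ≡-sym (sum-remove f) ⟩
  sum f                                       ∎
  where open ≤-Reasoning

sum-const : ∀ n c → sum {n} (λ _ → c) ≡ n * c
sum-const zero    c = refl
sum-const (suc n) c = cong (c +_) (sum-const n c)

𝟙 : ∀ {P : Set} → Dec P → ℕ
𝟙 P? = if does P? then 1 else 0

𝟙-yes : ∀ {P : Set} (P? : Dec P) → P → 𝟙 P? ≡ 1
𝟙-yes (yes _) _ = refl
𝟙-yes (no ¬p) p = ⊥-elim (¬p p)

𝟙-no : ∀ {P : Set} (P? : Dec P) → ¬ P → 𝟙 P? ≡ 0
𝟙-no (yes p) ¬p = ⊥-elim (¬p p)
𝟙-no (no _)  _  = refl

𝟙≤1 : ∀ {P : Set} (P? : Dec P) → 𝟙 P? ≤ 1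
𝟙≤1 (yes _) = s≤s z≤n
𝟙≤1 (no _)  = z≤n

𝟙-idem : ∀ {P : Set} (P? : Dec P) → 𝟙 P? * 𝟙 P? ≡ 𝟙 P?
𝟙-idem (yes _) = refl
𝟙-idem (no _)  = refl

δ : ∀ {n} → Fin n → Fin n → ℕ
δ a x = 𝟙 (x ≟ a)

sum-δ : ∀ {n} (a : Fin n) → sum (δ a) ≡ 1
sum-δ {suc n} zero    = cong (1 +_) (sum-replicate-zero n)
sum-δ {suc n} (suc a) = sum-δ a

-- For a bit i and a number s ≥ 2:  i·s + 2 ≤ s + 2i.  Summed over all
-- colours this turns "each colour is seen at least twice" into a bound.
bit-product-bound : ∀ {i s} → i ≤ 1 → 2 ≤ s → i * s + 2 ≤ s + 2 * i
bit-product-bound {zero}  {s} _ 2≤s = ≤-trans 2≤s (m≤m+n s 0)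
bit-product-bound {suc zero} {s} _ _ = ≤-reflexive (cong (_+ 2) (+-identityʳ s))
bit-product-bound {suc (suc _)} (s≤s ()) _

list-sum-tabulate : ∀ {n} (f : Fin n → ℕ) → List.sum (tabulate f) ≡ sum f
list-sum-tabulate {zero}  f = refl
list-sum-tabulate {suc n} f = cong (f zero +_) (list-sum-tabulate (f ∘ suc))

cancel-load : ∀ d L M N → d + L + M ≤ N + 2 * L → L ≤ 2 → d + M ≤ N + 2
cancel-load d L M N h L≤2 = +-cancelʳ-≤ L (d + M) (N + 2) (begin
  d + M + L   ≡⟨ swap-last d M L ⟩
  d + L + M   ≤⟨ h ⟩
  N + 2 * L   ≡⟨ double N L ⟩
  N + L + L   ≤⟨ +-monoˡ-≤ L (+-monoʳ-≤ N L≤2) ⟩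
  N + 2 + L   ∎)
  where
  open ≤-Reasoning
  swap-last : ∀ a b c → a + b + c ≡ a + c + b
  swap-last = solve-∀
  double : ∀ a b → a + 2 * b ≡ a + b + b
  double = solve-∀

module Counting {n m : ℕ} (G : Graph n) (c : EdgeColoring G m) where

  adj? : ∀ u w → Dec (Adj G u w)
  adj? u w = adj G u w ≟ᵇ true

  adj-sym : ∀ {u w} → Adj G u w → Adj G w u
  adj-sym {u} {w} uw = trans (≡-sym (sym G u w)) uw

  Sees : Fin n → Fin m → Set
  Sees u x = ∃[ w ] (Adj G u w × col c u w ≡ x)

  sees? : ∀ u x → Dec (Sees u x)
  sees? u x = any? (λ w → adj? u w ×-dec (col c u w ≟ x))

  sees : Fin n → Fin m → ℕ
  sees u x = 𝟙 (sees? u x)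

  sees-near : ∀ {u w} → Adj G u w → sees u (col c u w) ≡ 1
  sees-near {u} {w} uw = 𝟙-yes (sees? u _) (w , uw , refl)

  sees-far : ∀ {u w} → Adj G u w → sees w (col c u w) ≡ 1
  sees-far {u} {w} uw = 𝟙-yes (sees? w _) (u , adj-sym uw , ≡-sym (col-sym c u w uw))

  load : Fin n → ℕ
  load u = sum (sees u)

  spread : Fin m → ℕ
  spread x = sum (λ u → sees u x)

  -- By surjectivity every colour lies on an edge, whose two distinct ends see it.
  spread≥2 : ∀ x → 2 ≤ spread x
  spread≥2 x with surj c x
  ... | u , w , uw , refl = begin
    2                                       ≡⟨ ≡-sym (cong₂ _+_ (sees-near uw) (sees-far uw)) ⟩
    sees u (col c u w) + sees w (col c u w) ≤⟨ ≤-sum₂ (λ v → sees v (col c u w)) u≢w ⟩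
    spread (col c u w)                      ∎
    where
    open ≤-Reasoning
    u≢w : ¬ u ≡ w
    u≢w refl with trans (≡-sym uw) (irrefl G u)
    ... | ()

  two-colours : TwoValid c → ∀ u a → Adj G u a →
                ∃[ b ] (∀ x → Sees u x → x ≡ col c u a ⊎ x ≡ col c u b)
  two-colours tv u a ua with any? (λ b → adj? u b ×-dec ¬? (col c u b ≟ col c u a))
  ... | yes (b , ub , β≢α) = b , λ { x (w , uw , refl) → cover w uw }
    where
    cover : ∀ w → Adj G u w → col c u w ≡ col c u a ⊎ col c u w ≡ col c u b
    cover w uw with col c u w ≟ col c u a | col c u w ≟ col c u b
    ... | yes p | _     = inj₁ p
    ... | no _  | yes q = inj₂ q
    ... | no p  | no q  = ⊥-elim (tv u a b w ua ub uw (β≢α ∘ ≡-sym , p ∘ ≡-sym , q ∘ ≡-sym))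
  ... | no ∄b = a , λ { x (w , uw , refl) →
    inj₁ (decidable-stable (col c u w ≟ col c u a) (λ ne → ∄b (w , uw , ne))) }

  load≤2 : TwoValid c → ∀ u → load u ≤ 2
  load≤2 tv u with any? (adj? u)
  ... | no isolated = begin
    load u            ≤⟨ sum-mono-≤ (sees u) (λ _ → 0) unseen ⟩
    sum {m} (λ _ → 0) ≡⟨ sum-replicate-zero m ⟩
    0                 ≤⟨ z≤n ⟩
    2                 ∎
    where
    open ≤-Reasoning
    unseen : ∀ x → sees u x ≤ 0
    unseen x = ≤-reflexive (𝟙-no (sees? u x) λ (w , uw , _) → isolated (w , uw))
  ... | yes (a , ua) with two-colours tv u a ua
  ... | b , cover = begin
    load u                    ≤⟨ sum-mono-≤ (sees u) (λ x → δ α x + δ β x) bound ⟩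
    sum (λ x → δ α x + δ β x) ≡⟨ ∑-distrib-+ (δ α) (δ β) ⟩
    sum (δ α) + sum (δ β)     ≡⟨ cong₂ _+_ (sum-δ α) (sum-δ β) ⟩
    2                         ∎
    where
    open ≤-Reasoning
    α = col c u a
    β = col c u b
    bound : ∀ x → sees u x ≤ δ α x + δ β x
    bound x with sees? u x
    ... | no _ = z≤n
    ... | yes seen with cover x seen
    ... | inj₁ x≡α = ≤-trans (≤-reflexive (≡-sym (𝟙-yes (x ≟ α) x≡α))) (m≤m+n _ _)
    ... | inj₂ x≡β = ≤-trans (≤-reflexive (≡-sym (𝟙-yes (x ≟ β) x≡β))) (m≤n+m _ _)

  nbr : Fin n → Fin n → ℕ
  nbr v u = if adj G v u then 1 else 0

  degree≡∑nbr : ∀ v → degree G v ≡ sum (nbr v)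
  degree≡∑nbr v = trans (cong List.sum (map-tabulate id (nbr v))) (list-sum-tabulate (nbr v))

  common : Fin n → Fin n → ℕ
  common v u = sum (λ x → sees v x * sees u x)

  -- A neighbour u of v shares with v the colour of the edge vu, and v
  -- shares all of its load v colours with itself.
  common-bound : ∀ v u → nbr v u + δ v u * load v ≤ common v u
  common-bound v u with u ≟ v
  ... | yes refl = ≤-reflexive (begin
    nbr u u + 1 * load u ≡⟨ cong₂ _+_ (cong (λ b → if b then 1 else 0) (irrefl G u)) (*-identityˡ (load u)) ⟩
    load u               ≡⟨ sum-cong-≗ (λ x → ≡-sym (𝟙-idem (sees? u x))) ⟩
    common u u           ∎)
    where open ≡-Reasoning
  ... | no _ with adj G v u in vu
  ... | false = z≤n
  ... | true  = ≤-trans (≤-reflexive (≡-sym (cong₂ _*_ (sees-near vu) (sees-far vu))))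
                        (≤-sum (λ x → sees v x * sees u x) (col c v u))

  -- Counting the neighbours of v through the colours they share with v.
  degree+load≤ : ∀ v → degree G v + load v ≤ sum (λ x → sees v x * spread x)
  degree+load≤ v = begin
    degree G v + load v                       ≡⟨ cong₂ _+_ (degree≡∑nbr v) load≡δ*load ⟩
    sum (nbr v) + δ v v * load v              ≤⟨ +-monoʳ-≤ (sum (nbr v)) (≤-sum (λ u → δ v u * load v) v) ⟩
    sum (nbr v) + sum (λ u → δ v u * load v)  ≡⟨ ∑-distrib-+ (nbr v) (λ u → δ v u * load v) ⟨
    sum (λ u → nbr v u + δ v u * load v)      ≤⟨ sum-mono-≤ _ (common v) (common-bound v) ⟩
    sum (common v)                            ≡⟨ ∑-comm (λ u x → sees v x * sees u x) ⟩
    sum (λ x → sum (λ u → sees v x * sees u x)) ≡⟨ sum-cong-≗ (λ x → *-distribˡ-sum (sees v x) (λ u → sees u x)) ⟨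
    sum (λ x → sees v x * spread x)           ∎
    where
    open ≤-Reasoning
    load≡δ*load : load v ≡ δ v v * load v
    load≡δ*load = ≡-sym (trans (cong (_* load v) (𝟙-yes (v ≟ v) refl)) (*-identityˡ (load v)))

  -- Double counting the pairs (vertex, colour seen there): the spreads
  -- add up to the loads, hence to at most 2n.
  ∑spread≤2n : TwoValid c → sum spread ≤ 2 * n
  ∑spread≤2n tv = begin
    sum spread          ≡⟨ ∑-comm sees ⟨
    sum load            ≤⟨ sum-mono-≤ load (λ _ → 2) (load≤2 tv) ⟩
    sum {n} (λ _ → 2)   ≡⟨ trans (sum-const n 2) (*-comm n 2) ⟩
    2 * n               ∎
    where open ≤-Reasoning

  -- The key inequality: deg v + 2m ≤ 2n + 2.  Each colour x is seen at
  -- spread x ≥ 2 vertices; weighting the colours seen at v by their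
  -- spread and comparing with the total spread gives the bound.
  degree-bound : TwoValid c → ∀ v → degree G v + 2 * m ≤ 2 * n + 2
  degree-bound tv v = cancel-load (degree G v) (load v) (2 * m) (2 * n) (begin
    degree G v + load v + 2 * m             ≤⟨ +-monoˡ-≤ (2 * m) (degree+load≤ v) ⟩
    sum weighted + 2 * m                    ≡⟨ cong (sum weighted +_) (trans (*-comm 2 m) (≡-sym (sum-const m 2))) ⟩
    sum weighted + sum {m} (λ _ → 2)        ≡⟨ ∑-distrib-+ weighted (λ _ → 2) ⟨
    sum (λ x → weighted x + 2)              ≤⟨ sum-mono-≤ (λ x → weighted x + 2) (λ x → spread x + 2 * sees v x) pointwise ⟩
    sum (λ x → spread x + 2 * sees v x)     ≡⟨ ∑-distrib-+ spread (λ x → 2 * sees v x) ⟩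
    sum spread + sum (λ x → 2 * sees v x)   ≡⟨ cong (sum spread +_) (*-distribˡ-sum 2 (sees v)) ⟨
    sum spread + 2 * load v                 ≤⟨ +-monoˡ-≤ (2 * load v) (∑spread≤2n tv) ⟩
    2 * n + 2 * load v                      ∎) (load≤2 tv v)
    where
    open ≤-Reasoning
    weighted : Fin m → ℕ
    weighted x = sees v x * spread x
    pointwise : ∀ x → weighted x + 2 ≤ spread x + 2 * sees v x
    pointwise x = bit-product-bound (𝟙≤1 (sees? v x)) (spread≥2 x)

open Counting using (degree-bound)

degree≤3k+6 : ∀ d n m k → d + 2 * m ≤ 2 * n + 2 → n ∸ k ≤ m → d ≤ 3 * k + 6
degree≤3k+6 d n m k h n∸k≤m =
  ≤-trans d≤2k+2 (+-mono-≤ (*-monoˡ-≤ k {2} {3} (s≤s (s≤s z≤n))) (s≤s (s≤s z≤n)))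
  where
  open ≤-Reasoning
  n≤k+m : n ≤ k + m
  n≤k+m = ≤-trans (m≤n+m∸n n k) (+-monoʳ-≤ k n∸k≤m)
  regroup : ∀ a b → 2 * (a + b) + 2 ≡ 2 * a + 2 + 2 * b
  regroup = solve-∀
  d≤2k+2 : d ≤ 2 * k + 2
  d≤2k+2 = +-cancelʳ-≤ (2 * m) d (2 * k + 2) (begin
    d + 2 * m          ≤⟨ h ⟩
    2 * n + 2          ≤⟨ +-monoˡ-≤ 2 (*-monoʳ-≤ 2 n≤k+m) ⟩
    2 * (k + m) + 2    ≡⟨ regroup k m ⟩
    2 * k + 2 + 2 * m  ∎)

mainTheorem10 : (n : ℕ) (G : Graph n) (k : ℕ) →
    (∃[ m ] (n ∸ k ≤ m × Σ (EdgeColoring G m) TwoValid)) →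
    MaxDegreeAtMost G (3 * k + 6)
mainTheorem10 n G k (m , n∸k≤m , c , two-valid) v =
  degree≤3k+6 (degree G v) n m k (degree-bound G c two-valid v) n∸k≤m
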